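{- Let $m_1, l_2, m_2$ be positive integers with $m_1 < l_2 \le m_2$, and let $k$ be a positive integer. Then (a) $\displaystyle f([1,m_1]\cup[l_2,m_2]) = \sum_{d=1}^{m_2} \mu(d)\left(2^{\lfloor m_1/d\rfloor + \lfloor m_2/d\rfloor - \lfloor (l_2-1)/d\rfloor} - 1\right)$; (b) $\displaystyle f_k([1,m_1]\cup[l_2,m_2]) = \sum_{d=1}^{m_2} \mu(d) \binom{\lfloor m_1/d\rfloor + \lfloor m_2/d\rfloor - \lfloor (l_2-1)/d\rfloor}{k}$.
   Context: For positive integers $l \le m$, $[l,m] = \{l, l+1, \ldots, m\}$. For a nonempty finite set $A$ of positive integers, $f(A)$ is the number of nonempty subsets $X \subseteq A$ with $\gcd(X) = 1$, and $f_k(A)$ is the number of subsets $X \subseteq A$ with $\#X = k$ and $\gcd(X)=1$. $\mu$ is the Möbius function and $\lfloor x\rfloor$ the floor of $x$. -}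

module Defs where

open import Data.Nat using (ℕ; zero; suc; _+_; _*_; _∸_; _/_; NonZero)
open import Data.Nat.GCD using (gcd)
open import Data.Nat.Divisibility using (_∣_; _∣?_)
open import Data.Nat.Primality using (prime?)
open import Data.Nat.Combinatorics using (_C_)
open import Data.Nat.Properties using (_≟_)
open import Data.List using (List; []; _∷_; map; upTo; length; filter; foldr; _++_)
open import Data.Integer as ℤ using (ℤ; -_) renaming (+_ to pos)
open import Data.Bool using (if_then_else_)
open import Relation.Nullary using (¬?; does)
open import Relation.Nullary.Decidable using (_×-dec_)
open import Data.List.Relation.Unary.All using (all?)

interval : ℕ → ℕ → List ℕ
interval l m = map (λ i → l + i) (upTo (suc m ∸ l))

-- All subsets of a finite set represented as a list of distinct elements:
-- each sublist (choice of keep/drop for each element) is one subset.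
subsets : List ℕ → List (List ℕ)
subsets []       = [] ∷ []
subsets (x ∷ xs) = map (x ∷_) (subsets xs) ++ subsets xs

-- gcd of a finite set (gcd of the empty set is 0, irrelevant below).
gcdL : List ℕ → ℕ
gcdL = foldr gcd 0

nonempty? : List ℕ → Data.Bool.Bool
nonempty? []      = Data.Bool.false
nonempty? (_ ∷ _) = Data.Bool.true

f : List ℕ → ℕ
f A = length (filter (λ X → Relation.Nullary.Decidable.T? (nonempty? X) ×-dec (gcdL X ≟ 1)) (subsets A))

fₖ : ℕ → List ℕ → ℕ
fₖ k A = length (filter (λ X → (length X ≟ k) ×-dec (gcdL X ≟ 1)) (subsets A))

squarefree? : ℕ → Data.Bool.Bool
squarefree? n = does (all? (λ d → ¬? ((suc (suc d) * suc (suc d)) ∣? n)) (upTo n))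

ω : ℕ → ℕ
ω n = length (filter (λ p → prime? p ×-dec (p ∣? n)) (upTo (suc n)))

negOnePow : ℕ → ℤ
negOnePow zero    = pos 1
negOnePow (suc r) = - negOnePow r

μ : ℕ → ℤ
μ n = if squarefree? n then negOnePow (ω n) else pos 0

sumTo : ℕ → ((d : ℕ) → .{{NonZero d}} → ℤ) → ℤ
sumTo m g = foldr ℤ._+_ (pos 0) (map (λ i → g (suc i)) (upTo m))

{-# OPTIONS --safe #-}
-- For a nonempty X ⊆ [1,M], Möbius inversion gives [gcd X = 1] = Σ_{d≤M} μ(d) [d ∣ gcd X].
-- Summing over the admissible X and exchanging the sums, the coefficient of μ(d) counts the
-- admissible subsets of the c = ⌊m₁/d⌋ + ⌊m₂/d⌋ − ⌊(l₂−1)/d⌋ multiples of d in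
-- A = [1,m₁] ∪ [l₂,m₂]: 2^c − 1 nonempty ones and (c choose k) ones of size k.
-- The inversion formula Σ_{d≤n} μ(d) [d ∣ n] = [n = 1] is proved by choosing a prime p ∣ n:
-- the divisors p·j of n cancel the divisors prime to p, because μ(p·j) = −μ(j) when p ∤ j
-- and μ(p·j) = 0 otherwise.
module Submission where

open import Defs
open import Level using (0ℓ)
open import Algebra.Bundles using (CommutativeSemigroup)
open import Algebra.Structures using (IsCommutativeMonoid)
import Algebra.Properties.CommutativeSemigroup as CommutativeSemigroupProperties
open import Data.Bool using (Bool; true; false; _∧_; not; if_then_else_)
open import Data.Bool.Properties using (∧-identityʳ; ∧-zeroʳ)
open import Data.Empty using (⊥-elim)
open import Data.Integer using (ℤ; -_) renaming (+_ to pos; _+_ to _+ℤ_; _*_ to _*ℤ_)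
import Data.Integer.Properties as ℤP
open import Data.List using (List; []; _∷_; map; _++_; length; filter; foldr; applyUpTo; upTo)
open import Data.List.Properties using (filter-++; length-++)
open import Data.List.Relation.Unary.All as All using (All; []; _∷_; all?)
open import Data.List.Relation.Unary.All.Properties using (applyUpTo⁺₁; applyUpTo⁺₂; applyUpTo⁻; map⁺; ++⁺)
open import Data.Nat using (ℕ; zero; suc; _+_; _*_; _∸_; _^_; _/_; _%_; _≤_; _<_; _<ᵇ_; z≤n; s≤s; z<s; s<s; s≤s⁻¹; _≟_; NonZero; ≢-nonZero; >-nonZero; nonTrivial⇒n>1)
open import Data.Nat.Properties
open import Data.Nat.DivMod using (m≡m%n+[m/n]*n; m%n<n; %-pred-≡0; m/n*n≡m; m*[n/m]≡n; m<n⇒m%n≡m; m<n⇒m/n≡0; +-distrib-/; 0/n≡0; /-monoˡ-≤)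
open import Data.Nat.Divisibility using (_∣_; _∣?_; divides; ∣-trans; _∣0; ∣⇒≤; n∣m⇒m%n≡0; n∣m*n; m∣m*n; *-pres-∣; *-monoʳ-∣; *-cancelˡ-∣; ∣m+n∣m⇒∣n)
open import Data.Nat.GCD using (gcd; gcd[m,n]∣m; gcd[m,n]∣n; gcd-greatest; gcd[m,n]≡0⇒m≡0)
open import Data.Nat.Coprimality using (Coprime; coprime-divisor)
open import Data.Nat.Primality using (Prime; prime?; ¬prime[1]; euclidsLemma; prime⇒irreducible; prime⇒nonZero; prime⇒nonTrivial)
open import Data.Nat.Primality.Factorisation using (factorise)
open import Data.Nat.Combinatorics using (_C_; nCk+nC[k+1]≡[n+1]C[k+1])
open import Data.Product using (_×_; _,_; ∃-syntax)
open import Data.Sum using (inj₁; inj₂)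
open import Function using (_∘_; id; mk⇔)
open import Relation.Nullary using (Dec; yes; no; does; ¬_; ¬?; contradiction)
open import Relation.Nullary.Decidable using (dec-true; dec-false; does-⇔; _×-dec_)
open import Relation.Unary using (Pred; Decidable)
open import Relation.Binary.PropositionalEquality

module BigSum {A : Set} {_∙_ : A → A → A} {ε : A}
              (isCommutativeMonoid : IsCommutativeMonoid _≡_ _∙_ ε) where

  open IsCommutativeMonoid isCommutativeMonoid
    using (assoc; identityˡ; identityʳ; isCommutativeSemigroup)

  commutativeSemigroup : CommutativeSemigroup 0ℓ 0ℓ
  commutativeSemigroup = record { isCommutativeSemigroup = isCommutativeSemigroup }

  open CommutativeSemigroupProperties commutativeSemigroup using (interchange)

  sumBelow : ℕ → (ℕ → A) → A
  sumBelow zero    h = ε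
  sumBelow (suc n) h = h 0 ∙ sumBelow n (h ∘ suc)

  sumBelow-cong : ∀ n {g h} → (∀ i → i < n → g i ≡ h i) → sumBelow n g ≡ sumBelow n h
  sumBelow-cong zero    g≗h = refl
  sumBelow-cong (suc n) g≗h = cong₂ _∙_ (g≗h 0 z<s) (sumBelow-cong n (λ i i<n → g≗h (suc i) (s<s i<n)))

  sumBelow-zero : ∀ n {h} → (∀ i → i < n → h i ≡ ε) → sumBelow n h ≡ ε
  sumBelow-zero zero    h≗ε = refl
  sumBelow-zero (suc n) h≗ε =
    trans (cong₂ _∙_ (h≗ε 0 z<s) (sumBelow-zero n (λ i i<n → h≗ε (suc i) (s<s i<n)))) (identityˡ ε)

  sumBelow-suc : ∀ n h → sumBelow (suc n) h ≡ sumBelow n h ∙ h n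
  sumBelow-suc zero    h = trans (identityʳ (h 0)) (sym (identityˡ (h 0)))
  sumBelow-suc (suc n) h = trans (cong (h 0 ∙_) (sumBelow-suc n (h ∘ suc))) (sym (assoc _ _ _))

  sumBelow-+ : ∀ m n h → sumBelow (m + n) h ≡ sumBelow m h ∙ sumBelow n (λ i → h (m + i))
  sumBelow-+ zero    n h = sym (identityˡ _)
  sumBelow-+ (suc m) n h = trans (cong (h 0 ∙_) (sumBelow-+ m n (h ∘ suc))) (sym (assoc _ _ _))

  sumBelow-∙ : ∀ n g h → sumBelow n (λ i → g i ∙ h i) ≡ sumBelow n g ∙ sumBelow n h
  sumBelow-∙ zero    g h = sym (identityˡ ε)
  sumBelow-∙ (suc n) g h = trans (cong ((g 0 ∙ h 0) ∙_) (sumBelow-∙ n (g ∘ suc) (h ∘ suc))) (interchange _ _ _ _)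

  sumBelow-extend : ∀ {m n} h → m ≤ n → (∀ i → m ≤ i → i < n → h i ≡ ε) → sumBelow n h ≡ sumBelow m h
  sumBelow-extend {m} {n} h m≤n vanish = begin
    sumBelow n h                                       ≡⟨ cong (λ k → sumBelow k h) (m+[n∸m]≡n m≤n) ⟨
    sumBelow (m + (n ∸ m)) h                           ≡⟨ sumBelow-+ m (n ∸ m) h ⟩
    sumBelow m h ∙ sumBelow (n ∸ m) (λ i → h (m + i))  ≡⟨ cong (sumBelow m h ∙_) (sumBelow-zero (n ∸ m) tail-vanishes) ⟩
    sumBelow m h ∙ ε                                   ≡⟨ identityʳ _ ⟩
    sumBelow m h                                       ∎
    where
    open ≡-Reasoning
    tail-vanishes : ∀ i → i < n ∸ m → h (m + i) ≡ ε
    tail-vanishes i i<n∸m =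
      vanish (m + i) (m≤m+n m i) (subst (m + i <_) (m+[n∸m]≡n m≤n) (+-monoʳ-< m i<n∸m))

  -- Only the multiples of q contribute, and the i-th block of q consecutive terms contains
  -- exactly one of them, namely q·(i+1).
  sumBelow-multiples : ∀ q .{{_ : NonZero q}} K (g : ℕ → A) →
    sumBelow (q * K) (λ i → if does (q ∣? suc i) then g (suc i) else ε)
    ≡ sumBelow K (λ j → g (q * suc j))
  sumBelow-multiples (suc p) zero g =
    cong (λ n → sumBelow n (λ i → if does (suc p ∣? suc i) then g (suc i) else ε)) (*-zeroʳ p)
  sumBelow-multiples q@(suc p) (suc K) g = begin
    sumBelow (q * suc K) (atMultiple ∘ suc)
      ≡⟨ cong (λ n → sumBelow n (atMultiple ∘ suc)) (trans (*-suc q K) (+-comm q (q * K))) ⟩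
    sumBelow (q * K + q) (atMultiple ∘ suc)
      ≡⟨ sumBelow-+ (q * K) q (atMultiple ∘ suc) ⟩
    sumBelow (q * K) (atMultiple ∘ suc) ∙ sumBelow q (λ i → atMultiple (suc (q * K + i)))
      ≡⟨ cong₂ _∙_ (sumBelow-multiples q K g) block ⟩
    sumBelow K (λ j → g (q * suc j)) ∙ g (q * suc K)
      ≡⟨ sumBelow-suc K (λ j → g (q * suc j)) ⟨
    sumBelow (suc K) (λ j → g (q * suc j)) ∎
    where
    open ≡-Reasoning
    atMultiple : ℕ → A
    atMultiple d = if does (q ∣? d) then g d else ε
    last≡ : suc (q * K + p) ≡ q * suc K
    last≡ = trans (cong suc (+-comm (q * K) p)) (sym (*-suc q K))
    inner-vanishes : ∀ i → i < p → atMultiple (suc (q * K + i)) ≡ ε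
    inner-vanishes i i<p = cong (λ b → if b then g (suc (q * K + i)) else ε) (dec-false (q ∣? _) q∤)
      where
      q∤ : ¬ q ∣ suc (q * K + i)
      q∤ q∣ = <⇒≱ (s≤s i<p) (∣⇒≤ (∣m+n∣m⇒∣n (subst (q ∣_) (sym (+-suc (q * K) i)) q∣) (m∣m*n K)))
    block : sumBelow q (λ i → atMultiple (suc (q * K + i))) ≡ g (q * suc K)
    block = begin
      sumBelow q (λ i → atMultiple (suc (q * K + i)))
        ≡⟨ sumBelow-suc p _ ⟩
      sumBelow p (λ i → atMultiple (suc (q * K + i))) ∙ atMultiple (suc (q * K + p))
        ≡⟨ cong₂ _∙_ (sumBelow-zero p inner-vanishes) (cong atMultiple last≡) ⟩
      ε ∙ atMultiple (q * suc K)
        ≡⟨ identityˡ _ ⟩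
      atMultiple (q * suc K)
        ≡⟨ cong (λ b → if b then g (q * suc K) else ε) (dec-true (q ∣? q * suc K) (m∣m*n (suc K))) ⟩
      g (q * suc K) ∎

  sumOver : {B : Set} → List B → (B → A) → A
  sumOver []       h = ε
  sumOver (x ∷ xs) h = h x ∙ sumOver xs h

  sumOver-cong : ∀ {B : Set} (xs : List B) {g h} → All (λ x → g x ≡ h x) xs → sumOver xs g ≡ sumOver xs h
  sumOver-cong []       []           = refl
  sumOver-cong (x ∷ xs) (gx≡hx ∷ eqs) = cong₂ _∙_ gx≡hx (sumOver-cong xs eqs)

  sumOver-zero : ∀ {B : Set} (xs : List B) → sumOver xs (λ _ → ε) ≡ ε
  sumOver-zero []       = refl
  sumOver-zero (x ∷ xs) = trans (identityˡ _) (sumOver-zero xs)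

  sumOver-map : ∀ {B C : Set} (f : B → C) xs h → sumOver (map f xs) h ≡ sumOver xs (h ∘ f)
  sumOver-map f []       h = refl
  sumOver-map f (x ∷ xs) h = cong (h (f x) ∙_) (sumOver-map f xs h)

  sumOver-++ : ∀ {B : Set} (xs ys : List B) h → sumOver (xs ++ ys) h ≡ sumOver xs h ∙ sumOver ys h
  sumOver-++ []       ys h = sym (identityˡ _)
  sumOver-++ (x ∷ xs) ys h = trans (cong (h x ∙_) (sumOver-++ xs ys h)) (sym (assoc _ _ _))

  sumOver-applyUpTo : ∀ {B : Set} (f : ℕ → B) n h → sumOver (applyUpTo f n) h ≡ sumBelow n (h ∘ f)
  sumOver-applyUpTo f zero    h = refl
  sumOver-applyUpTo f (suc n) h = cong (h (f 0) ∙_) (sumOver-applyUpTo (f ∘ suc) n h)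

  sumOver-sumBelow : ∀ {B : Set} (xs : List B) n (h : B → ℕ → A) →
    sumOver xs (λ x → sumBelow n (h x)) ≡ sumBelow n (λ i → sumOver xs (λ x → h x i))
  sumOver-sumBelow []       n h = sym (sumBelow-zero n (λ _ _ → refl))
  sumOver-sumBelow (x ∷ xs) n h =
    trans (cong (sumBelow n (h x) ∙_) (sumOver-sumBelow xs n h)) (sym (sumBelow-∙ n (h x) _))

  sumOver-subsets-∷ : ∀ x xs h →
    sumOver (subsets (x ∷ xs)) h ≡ sumOver (subsets xs) (h ∘ (x ∷_)) ∙ sumOver (subsets xs) h
  sumOver-subsets-∷ x xs h =
    trans (sumOver-++ (map (x ∷_) (subsets xs)) (subsets xs) h)
          (cong (_∙ sumOver (subsets xs) h) (sumOver-map (x ∷_) (subsets xs) h))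

  foldr-map≡sumOver : ∀ {B : Set} (xs : List B) h → foldr _∙_ ε (map h xs) ≡ sumOver xs h
  foldr-map≡sumOver []       h = refl
  foldr-map≡sumOver (x ∷ xs) h = cong (h x ∙_) (foldr-map≡sumOver xs h)

module ℕΣ = BigSum +-0-isCommutativeMonoid
module ℤΣ = BigSum ℤP.+-0-isCommutativeMonoid

pos-sumOver : ∀ {B : Set} (xs : List B) h → pos (ℕΣ.sumOver xs h) ≡ ℤΣ.sumOver xs (pos ∘ h)
pos-sumOver []       h = refl
pos-sumOver (x ∷ xs) h = trans (ℤP.pos-+ (h x) _) (cong (pos (h x) +ℤ_) (pos-sumOver xs h))

*-distribˡ-sumOver : ∀ {B : Set} c (xs : List B) h → c *ℤ ℤΣ.sumOver xs h ≡ ℤΣ.sumOver xs (λ x → c *ℤ h x)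
*-distribˡ-sumOver c []       h = ℤP.*-zeroʳ c
*-distribˡ-sumOver c (x ∷ xs) h =
  trans (ℤP.*-distribˡ-+ c (h x) _) (cong (c *ℤ h x +ℤ_) (*-distribˡ-sumOver c xs h))

sumTo≡sumBelow : ∀ m (g : (d : ℕ) → .{{NonZero d}} → ℤ) → sumTo m g ≡ ℤΣ.sumBelow m (λ i → g (suc i))
sumTo≡sumBelow m g = trans (ℤΣ.foldr-map≡sumOver (upTo m) _) (ℤΣ.sumOver-applyUpTo id m _)

𝟙 : Bool → ℕ
𝟙 true  = 1
𝟙 false = 0

length-filter≡sum𝟙 : ∀ {B : Set} {ℓ} {P : Pred B ℓ} (P? : Decidable P) xs →
  length (filter P? xs) ≡ ℕΣ.sumOver xs (λ x → 𝟙 (does (P? x)))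
length-filter≡sum𝟙 P? []       = refl
length-filter≡sum𝟙 P? (x ∷ xs) with does (P? x)
... | true  = cong suc (length-filter≡sum𝟙 P? xs)
... | false = length-filter≡sum𝟙 P? xs

-- Counting multiples

[1+n]/d≡1+n/d : ∀ n d .{{_ : NonZero d}} → d ∣ suc n → suc n / d ≡ suc (n / d)
[1+n]/d≡1+n/d n d d∣1+n = *-cancelʳ-≡ (suc n / d) (suc (n / d)) d (begin
  suc n / d * d            ≡⟨ m/n*n≡m d∣1+n ⟩
  suc n                    ≡⟨ cong suc (m≡m%n+[m/n]*n n d) ⟩
  suc (n % d) + n / d * d  ≡⟨ cong (λ r → suc r + n / d * d) (%-pred-≡0 (n∣m⇒m%n≡0 (suc n) d d∣1+n)) ⟩
  suc (d ∸ 1) + n / d * d  ≡⟨ cong (_+ n / d * d) (suc-pred d) ⟩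
  suc (n / d) * d          ∎)
  where open ≡-Reasoning

[1+n]/d≡n/d : ∀ n d .{{_ : NonZero d}} → ¬ d ∣ suc n → suc n / d ≡ n / d
[1+n]/d≡n/d n d d∤1+n with m≤n⇒m<n∨m≡n (m%n<n n d)
... | inj₂ 1+n%d≡d =
  contradiction (divides (suc (n / d)) (trans (cong suc (m≡m%n+[m/n]*n n d)) (cong (_+ n / d * d) 1+n%d≡d))) d∤1+n
... | inj₁ 1+n%d<d = begin
  suc n / d        ≡⟨ cong (_/ d) (+-comm 1 n) ⟩
  (n + 1) / d      ≡⟨ +-distrib-/ n 1 no-carry ⟩
  n / d + 1 / d    ≡⟨ cong (n / d +_) (m<n⇒m/n≡0 1<d) ⟩
  n / d + 0        ≡⟨ +-identityʳ _ ⟩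
  n / d            ∎
  where
  open ≡-Reasoning
  1<d : 1 < d
  1<d = <-≤-trans (s≤s z<s) 1+n%d<d
  no-carry : n % d + 1 % d < d
  no-carry = subst (_< d) (trans (+-comm 1 (n % d)) (cong (n % d +_) (sym (m<n⇒m%n≡m 1<d)))) 1+n%d<d

[1+n]/d≡n/d+𝟙[d∣1+n] : ∀ n d .{{_ : NonZero d}} → suc n / d ≡ n / d + 𝟙 (does (d ∣? suc n))
[1+n]/d≡n/d+𝟙[d∣1+n] n d with d ∣? suc n
... | yes d∣1+n = trans ([1+n]/d≡1+n/d n d d∣1+n) (+-comm 1 (n / d))
... | no  d∤1+n = trans ([1+n]/d≡n/d n d d∤1+n) (sym (+-identityʳ _))

sum𝟙[d∣1+j]≡n/d : ∀ n d .{{_ : NonZero d}} → ℕΣ.sumBelow n (λ j → 𝟙 (does (d ∣? suc j))) ≡ n / d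
sum𝟙[d∣1+j]≡n/d zero    d = sym (0/n≡0 d)
sum𝟙[d∣1+j]≡n/d (suc n) d = begin
  ℕΣ.sumBelow (suc n) multiple                   ≡⟨ ℕΣ.sumBelow-suc n multiple ⟩
  ℕΣ.sumBelow n multiple + multiple n            ≡⟨ cong (_+ multiple n) (sum𝟙[d∣1+j]≡n/d n d) ⟩
  n / d + 𝟙 (does (d ∣? suc n))                  ≡⟨ [1+n]/d≡n/d+𝟙[d∣1+n] n d ⟨
  suc n / d                                      ∎
  where
  open ≡-Reasoning
  multiple : ℕ → ℕ
  multiple j = 𝟙 (does (d ∣? suc j))

length-filter-∣-interval : ∀ d .{{_ : NonZero d}} {l m} → l ≤ m →
  length (filter (d ∣?_) (interval (suc l) m)) ≡ m / d ∸ l / d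
length-filter-∣-interval d {l} {m} l≤m = begin
  length (filter (d ∣?_) (interval (suc l) m))
    ≡⟨ length-filter≡sum𝟙 (d ∣?_) (interval (suc l) m) ⟩
  ℕΣ.sumOver (map (suc l +_) (upTo (m ∸ l))) (𝟙 ∘ does ∘ (d ∣?_))
    ≡⟨ ℕΣ.sumOver-map (suc l +_) (upTo (m ∸ l)) _ ⟩
  ℕΣ.sumOver (upTo (m ∸ l)) (λ i → multiple (l + i))
    ≡⟨ ℕΣ.sumOver-applyUpTo id (m ∸ l) _ ⟩
  above-l
    ≡⟨ m+n∸m≡n (ℕΣ.sumBelow l multiple) above-l ⟨
  ℕΣ.sumBelow l multiple + above-l ∸ ℕΣ.sumBelow l multiple
    ≡⟨ cong (_∸ ℕΣ.sumBelow l multiple) (ℕΣ.sumBelow-+ l (m ∸ l) multiple) ⟨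
  ℕΣ.sumBelow (l + (m ∸ l)) multiple ∸ ℕΣ.sumBelow l multiple
    ≡⟨ cong (λ n → ℕΣ.sumBelow n multiple ∸ ℕΣ.sumBelow l multiple) (m+[n∸m]≡n l≤m) ⟩
  ℕΣ.sumBelow m multiple ∸ ℕΣ.sumBelow l multiple
    ≡⟨ cong₂ _∸_ (sum𝟙[d∣1+j]≡n/d m d) (sum𝟙[d∣1+j]≡n/d l d) ⟩
  m / d ∸ l / d ∎
  where
  open ≡-Reasoning
  multiple : ℕ → ℕ
  multiple j = 𝟙 (does (d ∣? suc j))
  above-l : ℕ
  above-l = ℕΣ.sumBelow (m ∸ l) (λ i → multiple (l + i))

length-filter-∣-union : ∀ d .{{_ : NonZero d}} m₁ {l m₂} → l ≤ m₂ →
  length (filter (d ∣?_) (interval 1 m₁ ++ interval (suc l) m₂)) ≡ m₁ / d + m₂ / d ∸ l / d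
length-filter-∣-union d m₁ {l} {m₂} l≤m₂ = begin
  length (filter (d ∣?_) (interval 1 m₁ ++ interval (suc l) m₂))
    ≡⟨ cong length (filter-++ (d ∣?_) (interval 1 m₁) (interval (suc l) m₂)) ⟩
  length (filter (d ∣?_) (interval 1 m₁) ++ filter (d ∣?_) (interval (suc l) m₂))
    ≡⟨ length-++ (filter (d ∣?_) (interval 1 m₁)) ⟩
  length (filter (d ∣?_) (interval 1 m₁)) + length (filter (d ∣?_) (interval (suc l) m₂))
    ≡⟨ cong₂ _+_ (trans (length-filter-∣-interval d z≤n) (cong (m₁ / d ∸_) (0/n≡0 d)))
                 (length-filter-∣-interval d l≤m₂) ⟩
  m₁ / d + (m₂ / d ∸ l / d)
    ≡⟨ +-∸-assoc (m₁ / d) (/-monoˡ-≤ d l≤m₂) ⟨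
  m₁ / d + m₂ / d ∸ l / d ∎
  where open ≡-Reasoning

interval-bounds : ∀ l m → All (λ x → l ≤ x × x ≤ m) (interval l m)
interval-bounds l m = map⁺ (applyUpTo⁺₁ id (suc m ∸ l) bounds)
  where
  bounds : ∀ {i} → i < suc m ∸ l → l ≤ l + i × l + i ≤ m
  bounds {i} i<1+m∸l = m≤m+n l i , s≤s⁻¹ (subst (_≤ suc m) (trans (+-comm (suc i) l) (+-suc l i))
    (m≤o∸n⇒m+n≤o (suc i) (<⇒≤ (m∸n≢0⇒n<m (m<n⇒n≢0 i<1+m∸l))) i<1+m∸l))

-- Counting subsets by size and divisibility

#subsets : (ℕ → Bool) → List ℕ → ℕ
#subsets P xs = ℕΣ.sumOver (subsets xs) (λ X → 𝟙 (P (length X)))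

#subsets-∷ : ∀ P x xs → #subsets P (x ∷ xs) ≡ #subsets (P ∘ suc) xs + #subsets P xs
#subsets-∷ P x xs = ℕΣ.sumOver-subsets-∷ x xs _

#subsets-all : ∀ xs → #subsets (λ _ → true) xs ≡ 2 ^ length xs
#subsets-all []       = refl
#subsets-all (x ∷ xs) = begin
  #subsets (λ _ → true) (x ∷ xs)                  ≡⟨ #subsets-∷ (λ _ → true) x xs ⟩
  #subsets (λ _ → true) xs + #subsets (λ _ → true) xs ≡⟨ cong₂ _+_ (#subsets-all xs) (#subsets-all xs) ⟩
  2 ^ length xs + 2 ^ length xs                   ≡⟨ cong (2 ^ length xs +_) (+-identityʳ _) ⟨
  2 ^ suc (length xs)                             ∎
  where open ≡-Reasoning

#subsets-nonempty : ∀ xs → #subsets (0 <ᵇ_) xs ≡ 2 ^ length xs ∸ 1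
#subsets-nonempty []       = refl
#subsets-nonempty (x ∷ xs) = begin
  #subsets (0 <ᵇ_) (x ∷ xs)                     ≡⟨ #subsets-∷ (0 <ᵇ_) x xs ⟩
  #subsets (λ _ → true) xs + #subsets (0 <ᵇ_) xs ≡⟨ cong₂ _+_ (#subsets-all xs) (#subsets-nonempty xs) ⟩
  2 ^ n + (2 ^ n ∸ 1)                           ≡⟨ +-∸-assoc (2 ^ n) (m^n>0 2 n) ⟨
  2 ^ n + 2 ^ n ∸ 1                             ≡⟨ cong (λ m → 2 ^ n + m ∸ 1) (+-identityʳ (2 ^ n)) ⟨
  2 ^ suc n ∸ 1                                 ∎
  where
  open ≡-Reasoning
  n : ℕ
  n = length xs

#subsets-ofSize : ∀ k xs → #subsets (λ n → does (n ≟ k)) xs ≡ length xs C k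
#subsets-ofSize zero    []       = refl
#subsets-ofSize (suc k) []       = refl
#subsets-ofSize zero    (x ∷ xs) =
  trans (#subsets-∷ (λ n → does (n ≟ zero)) x xs) (cong₂ _+_ (ℕΣ.sumOver-zero (subsets xs)) (#subsets-ofSize zero xs))
#subsets-ofSize (suc k) (x ∷ xs) =
  trans (#subsets-∷ (λ n → does (n ≟ suc k)) x xs)
        (trans (cong₂ _+_ (#subsets-ofSize k xs) (#subsets-ofSize (suc k) xs))
               (nCk+nC[k+1]≡[n+1]C[k+1] (length xs) k))

#subsets∣ : ℕ → (ℕ → Bool) → List ℕ → ℕ
#subsets∣ d P A = ℕΣ.sumOver (subsets A) (λ X → 𝟙 (P (length X) ∧ does (d ∣? gcdL X)))

∣-gcd-∣ : ∀ {d x} y → d ∣ x → does (d ∣? gcd x y) ≡ does (d ∣? y)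
∣-gcd-∣ {d} {x} y d∣x =
  does-⇔ (mk⇔ (λ d∣g → ∣-trans d∣g (gcd[m,n]∣n x y)) (gcd-greatest d∣x)) (d ∣? gcd x y) (d ∣? y)

∤-gcd : ∀ {d x} y → ¬ d ∣ x → does (d ∣? gcd x y) ≡ false
∤-gcd {d} {x} y d∤x = dec-false (d ∣? gcd x y) (λ d∣g → d∤x (∣-trans d∣g (gcd[m,n]∣m x y)))

-- X ↦ X is a bijection between the subsets of A all of whose elements are divisible by d
-- and the subsets of the multiples of d in A.
#subsets∣≡#subsets-filter : ∀ d P A → #subsets∣ d P A ≡ #subsets P (filter (d ∣?_) A)
#subsets∣≡#subsets-filter d P [] =
  trans (cong (λ b → 𝟙 (P 0 ∧ b) + 0) (dec-true (d ∣? 0) (d ∣0))) (cong (λ b → 𝟙 b + 0) (∧-identityʳ (P 0)))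
#subsets∣≡#subsets-filter d P (x ∷ xs) with d ∣? x
... | yes d∣x = begin
  #subsets∣ d P (x ∷ xs)
    ≡⟨ ℕΣ.sumOver-subsets-∷ x xs _ ⟩
  ℕΣ.sumOver (subsets xs) (λ X → 𝟙 (P (suc (length X)) ∧ does (d ∣? gcd x (gcdL X)))) + #subsets∣ d P xs
    ≡⟨ cong (_+ #subsets∣ d P xs) (ℕΣ.sumOver-cong (subsets xs)
         (All.universal (λ X → cong (λ b → 𝟙 (P (suc (length X)) ∧ b)) (∣-gcd-∣ (gcdL X) d∣x)) _)) ⟩
  #subsets∣ d (P ∘ suc) xs + #subsets∣ d P xs
    ≡⟨ cong₂ _+_ (#subsets∣≡#subsets-filter d (P ∘ suc) xs) (#subsets∣≡#subsets-filter d P xs) ⟩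
  #subsets (P ∘ suc) (filter (d ∣?_) xs) + #subsets P (filter (d ∣?_) xs)
    ≡⟨ #subsets-∷ P x (filter (d ∣?_) xs) ⟨
  #subsets P (x ∷ filter (d ∣?_) xs) ∎
  where open ≡-Reasoning
... | no d∤x = begin
  #subsets∣ d P (x ∷ xs)
    ≡⟨ ℕΣ.sumOver-subsets-∷ x xs _ ⟩
  ℕΣ.sumOver (subsets xs) (λ X → 𝟙 (P (suc (length X)) ∧ does (d ∣? gcd x (gcdL X)))) + #subsets∣ d P xs
    ≡⟨ cong (_+ #subsets∣ d P xs) (trans (ℕΣ.sumOver-cong (subsets xs)
         (All.universal (λ X → cong (λ b → 𝟙 (P (suc (length X)) ∧ b)) (∤-gcd (gcdL X) d∤x)) _))
         (trans (ℕΣ.sumOver-cong (subsets xs) (All.universal (λ X → cong 𝟙 (∧-zeroʳ _)) _))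
                (ℕΣ.sumOver-zero (subsets xs)))) ⟩
  #subsets∣ d P xs
    ≡⟨ #subsets∣≡#subsets-filter d P xs ⟩
  #subsets P (filter (d ∣?_) xs) ∎
  where open ≡-Reasoning

-- The Möbius function

SquareFree : ℕ → Set
SquareFree n = ∀ q → ¬ (suc (suc q) * suc (suc q) ∣ n)

squarefree?-complete : ∀ {n} → SquareFree n → squarefree? n ≡ true
squarefree?-complete {n} sf =
  dec-true (all? (λ d → ¬? (suc (suc d) * suc (suc d) ∣? n)) (upTo n)) (applyUpTo⁺₂ id n sf)

does≡true⇒ : ∀ {P : Set} (P? : Dec P) → does P? ≡ true → P
does≡true⇒ (yes p) _  = p
does≡true⇒ (no _)  ()

squarefree?-sound : ∀ {n} .{{_ : NonZero n}} → squarefree? n ≡ true → SquareFree n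
squarefree?-sound {n} sf q [2+q]²∣n =
  applyUpTo⁻ id n (does≡true⇒ (all? (λ d → ¬? (suc (suc d) * suc (suc d) ∣? n)) (upTo n)) sf)
    (<-≤-trans (≤-trans (n≤1+n (suc q)) (m≤m+n (suc (suc q)) _)) (∣⇒≤ [2+q]²∣n)) [2+q]²∣n

SquareFree⇒¬m²∣ : ∀ {m n} → SquareFree n → 1 < m → ¬ m * m ∣ n
SquareFree⇒¬m²∣ {suc (suc q)} sf _        = sf q
SquareFree⇒¬m²∣ {1}           _  (s≤s ())

SquareFree-*-cancelˡ : ∀ m {n} → SquareFree (m * n) → SquareFree n
SquareFree-*-cancelˡ m sf q [2+q]²∣n = sf q (∣-trans [2+q]²∣n (n∣m*n m))

prime∤⇒coprime : ∀ {p m} → Prime p → ¬ p ∣ m → Coprime m p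
prime∤⇒coprime pp p∤m {i} (i∣m , i∣p) with prime⇒irreducible pp i∣p
... | inj₁ i≡1 = i≡1
... | inj₂ refl = contradiction i∣m p∤m

distinct-primes-∤ : ∀ {p q} → Prime p → Prime q → p ≢ q → ¬ p ∣ q
distinct-primes-∤ pp pq p≢q p∣q with prime⇒irreducible pq p∣q
... | inj₁ refl = ¬prime[1] pp
... | inj₂ p≡q  = p≢q p≡q

SquareFree-prime-* : ∀ {p e} → Prime p → ¬ p ∣ e → SquareFree e → SquareFree (p * e)
SquareFree-prime-* {p} {e} pp p∤e sf q [2+q]²∣pe with p ∣? suc (suc q)
... | yes p∣2+q = p∤e (*-cancelˡ-∣ p {{prime⇒nonZero pp}} (∣-trans (*-pres-∣ p∣2+q p∣2+q) [2+q]²∣pe))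
... | no  p∤2+q = sf q (coprime-divisor (prime∤⇒coprime pp p∤[2+q]²) [2+q]²∣pe)
  where
  p∤[2+q]² : ¬ p ∣ suc (suc q) * suc (suc q)
  p∤[2+q]² p∣ with euclidsLemma (suc (suc q)) (suc (suc q)) pp p∣
  ... | inj₁ p∣2+q = p∤2+q p∣2+q
  ... | inj₂ p∣2+q = p∤2+q p∣2+q

primeDivides? : ℕ → ℕ → Bool
primeDivides? p n = does (prime? p) ∧ does (p ∣? n)

ω≡sum : ∀ n → ω n ≡ ℕΣ.sumBelow (suc n) (λ i → 𝟙 (primeDivides? i n))
ω≡sum n = trans (length-filter≡sum𝟙 (λ p → prime? p ×-dec (p ∣? n)) (upTo (suc n)))
                (ℕΣ.sumOver-applyUpTo id (suc n) (λ i → 𝟙 (primeDivides? i n)))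

primeDivides?-prime-*-≢ : ∀ {p e} → Prime p → ∀ {i} → i ≢ p → primeDivides? i (p * e) ≡ primeDivides? i e
primeDivides?-prime-*-≢ {p} {e} pp {i} i≢p with prime? i
... | no _   = refl
... | yes pi = does-⇔ (mk⇔ (coprime-divisor i⊥p) (λ i∣e → ∣-trans i∣e (n∣m*n p))) (i ∣? p * e) (i ∣? e)
  where
  i⊥p : Coprime i p
  i⊥p = prime∤⇒coprime pp (distinct-primes-∤ pp pi (i≢p ∘ sym))

primeDivides?-prime-* : ∀ {p e} → Prime p → ¬ p ∣ e → ∀ i →
  𝟙 (primeDivides? i (p * e)) ≡ 𝟙 (does (i ≟ p)) + 𝟙 (primeDivides? i e)
primeDivides?-prime-* {p} {e} pp p∤e i with i ≟ p
... | yes refl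
  rewrite dec-true (prime? p) pp | dec-true (p ∣? p * e) (m∣m*n e) | dec-false (p ∣? e) p∤e =
    cong (λ b → 𝟙 b + 0) (sym (dec-true (p ≟ p) refl))
... | no i≢p = trans (cong 𝟙 (primeDivides?-prime-*-≢ pp i≢p))
                     (cong (λ b → 𝟙 b + 𝟙 (primeDivides? i e)) (sym (dec-false (i ≟ p) i≢p)))

sum𝟙[i≡p]≡1 : ∀ {p N} → p < N → ℕΣ.sumBelow N (λ i → 𝟙 (does (i ≟ p))) ≡ 1
sum𝟙[i≡p]≡1 {p} {N} p<N = begin
  ℕΣ.sumBelow N (λ i → 𝟙 (does (i ≟ p)))
    ≡⟨ ℕΣ.sumBelow-extend _ p<N (λ i p<i _ → cong 𝟙 (dec-false (i ≟ p) (>⇒≢ p<i))) ⟩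
  ℕΣ.sumBelow (suc p) (λ i → 𝟙 (does (i ≟ p)))
    ≡⟨ ℕΣ.sumBelow-suc p _ ⟩
  ℕΣ.sumBelow p (λ i → 𝟙 (does (i ≟ p))) + 𝟙 (does (p ≟ p))
    ≡⟨ cong₂ _+_ (ℕΣ.sumBelow-zero p (λ i i<p → cong 𝟙 (dec-false (i ≟ p) (<⇒≢ i<p))))
                 (cong 𝟙 (dec-true (p ≟ p) refl)) ⟩
  1 ∎
  where open ≡-Reasoning

ω-prime-* : ∀ {p e} .{{_ : NonZero e}} → Prime p → ¬ p ∣ e → ω (p * e) ≡ suc (ω e)
ω-prime-* {p} {e} pp p∤e = begin
  ω (p * e)
    ≡⟨ ω≡sum (p * e) ⟩
  ℕΣ.sumBelow (suc (p * e)) (λ i → 𝟙 (primeDivides? i (p * e)))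
    ≡⟨ ℕΣ.sumBelow-cong (suc (p * e)) (λ i _ → primeDivides?-prime-* pp p∤e i) ⟩
  ℕΣ.sumBelow (suc (p * e)) (λ i → 𝟙 (does (i ≟ p)) + 𝟙 (primeDivides? i e))
    ≡⟨ ℕΣ.sumBelow-∙ (suc (p * e)) (λ i → 𝟙 (does (i ≟ p))) (λ i → 𝟙 (primeDivides? i e)) ⟩
  ℕΣ.sumBelow (suc (p * e)) (λ i → 𝟙 (does (i ≟ p))) + ℕΣ.sumBelow (suc (p * e)) (λ i → 𝟙 (primeDivides? i e))
    ≡⟨ cong₂ _+_ (sum𝟙[i≡p]≡1 (s≤s (m≤m*n p e)))
                 (ℕΣ.sumBelow-extend _ (s≤s (m≤n*m e p {{prime⇒nonZero pp}})) (λ i e<i _ → beyond-e i e<i)) ⟩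
  suc (ℕΣ.sumBelow (suc e) (λ i → 𝟙 (primeDivides? i e)))
    ≡⟨ cong suc (ω≡sum e) ⟨
  suc (ω e) ∎
  where
  open ≡-Reasoning
  beyond-e : ∀ i → e < i → 𝟙 (primeDivides? i e) ≡ 0
  beyond-e i e<i = cong 𝟙 (trans (cong (does (prime? i) ∧_) (dec-false (i ∣? e) (λ i∣e → <⇒≱ e<i (∣⇒≤ i∣e))))
                                 (∧-zeroʳ _))

μ-squarefree : ∀ {n} → squarefree? n ≡ true → μ n ≡ negOnePow (ω n)
μ-squarefree {n} sf = cong (λ b → if b then negOnePow (ω n) else pos 0) sf

μ-prime-*-∣ : ∀ {p e} .{{_ : NonZero e}} → Prime p → p ∣ e → μ (p * e) ≡ pos 0
μ-prime-*-∣ {p} {e} pp p∣e with squarefree? (p * e) in sf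
... | false = refl
... | true  = ⊥-elim (SquareFree⇒¬m²∣ (squarefree?-sound {p * e} {{m*n≢0 p e {{prime⇒nonZero pp}}}} sf)
                (nonTrivial⇒n>1 p {{prime⇒nonTrivial pp}}) (*-monoʳ-∣ p p∣e))

μ-prime-*-∤ : ∀ {p e} .{{_ : NonZero e}} → Prime p → ¬ p ∣ e → μ (p * e) ≡ - μ e
μ-prime-*-∤ {p} {e} pp p∤e with squarefree? e in sf
... | true = begin
  μ (p * e)              ≡⟨ μ-squarefree {p * e} (squarefree?-complete (SquareFree-prime-* pp p∤e (squarefree?-sound {e} sf))) ⟩
  negOnePow (ω (p * e))  ≡⟨ cong negOnePow (ω-prime-* pp p∤e) ⟩
  - negOnePow (ω e)      ∎
  where open ≡-Reasoning
... | false with squarefree? (p * e) in sf′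
...   | true  = contradiction
                  (trans (sym sf) (squarefree?-complete (SquareFree-*-cancelˡ p
                    (squarefree?-sound {p * e} {{m*n≢0 p e {{prime⇒nonZero pp}}}} sf′))))
                  λ ()
...   | false = refl

prime-factor : ∀ m → ∃[ p ] Prime p × p ∣ suc (suc m)
prime-factor m with factorise (suc (suc m))
... | record { factors = [] ; isFactorisation = () }
... | record { factors = p ∷ _ ; isFactorisation = n≡∏ ; factorsPrime = pp ∷ _ } =
  p , pp , subst (p ∣_) (sym n≡∏) (m∣m*n _)

divisorSumμ : ℕ → ℕ → ℤ
divisorSumμ M n = ℤΣ.sumBelow M (λ i → μ (suc i) *ℤ pos (𝟙 (does (suc i ∣? n))))

divisorSumμ-prime-* : ∀ {p} K .{{_ : NonZero K}} → Prime p → divisorSumμ (p * K) (p * K) ≡ pos 0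
divisorSumμ-prime-* {p} K pp = begin
  divisorSumμ (p * K) (p * K)
    ≡⟨ ℤΣ.sumBelow-cong (p * K) (λ i _ → split (suc i)) ⟩
  ℤΣ.sumBelow (p * K) (λ i → prime-to-p (suc i) +ℤ multiple-of-p (suc i))
    ≡⟨ ℤΣ.sumBelow-∙ (p * K) (prime-to-p ∘ suc) (multiple-of-p ∘ suc) ⟩
  ℤΣ.sumBelow (p * K) (prime-to-p ∘ suc) +ℤ ℤΣ.sumBelow (p * K) (multiple-of-p ∘ suc)
    ≡⟨ cong₂ _+ℤ_ (ℤΣ.sumBelow-extend (prime-to-p ∘ suc) (m≤n*m K p) (λ i K≤i _ → beyond-K i K≤i))
                  (ℤΣ.sumBelow-multiples p K g) ⟩
  ℤΣ.sumBelow K (prime-to-p ∘ suc) +ℤ ℤΣ.sumBelow K (λ j → g (p * suc j))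
    ≡⟨ cong (ℤΣ.sumBelow K (prime-to-p ∘ suc) +ℤ_) (ℤΣ.sumBelow-cong K (λ j _ → g-at-multiple j)) ⟩
  ℤΣ.sumBelow K (prime-to-p ∘ suc) +ℤ ℤΣ.sumBelow K (λ j → - prime-to-p (suc j))
    ≡⟨ ℤΣ.sumBelow-∙ K (prime-to-p ∘ suc) (λ j → - prime-to-p (suc j)) ⟨
  ℤΣ.sumBelow K (λ j → prime-to-p (suc j) +ℤ - prime-to-p (suc j))
    ≡⟨ ℤΣ.sumBelow-zero K (λ j _ → ℤP.+-inverseʳ (prime-to-p (suc j))) ⟩
  pos 0 ∎
  where
  open ≡-Reasoning
  instance
    p≢0 : NonZero p
    p≢0 = prime⇒nonZero pp
  g : ℕ → ℤ
  g d = μ d *ℤ pos (𝟙 (does (d ∣? p * K)))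
  prime-to-p : ℕ → ℤ
  prime-to-p d = μ d *ℤ pos (𝟙 (not (does (p ∣? d)) ∧ does (d ∣? K)))
  multiple-of-p : ℕ → ℤ
  multiple-of-p d = if does (p ∣? d) then g d else pos 0

  split : ∀ d → g d ≡ μ d *ℤ pos (𝟙 (not (does (p ∣? d)) ∧ does (d ∣? K)))
                     +ℤ (if does (p ∣? d) then g d else pos 0)
  split d with p ∣? d
  ... | yes _   = sym (trans (cong (_+ℤ g d) (ℤP.*-zeroʳ (μ d))) (ℤP.+-identityˡ (g d)))
  ... | no  p∤d = trans (cong (λ b → μ d *ℤ pos (𝟙 b)) d∣pK⇔d∣K) (sym (ℤP.+-identityʳ _))
    where
    d∣pK⇔d∣K : does (d ∣? p * K) ≡ does (d ∣? K)
    d∣pK⇔d∣K = does-⇔ (mk⇔ (coprime-divisor (prime∤⇒coprime pp p∤d)) (λ d∣K → ∣-trans d∣K (n∣m*n p)))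
                      (d ∣? p * K) (d ∣? K)

  beyond-K : ∀ i → K ≤ i → prime-to-p (suc i) ≡ pos 0
  beyond-K i K≤i rewrite dec-false (suc i ∣? K) (λ 1+i∣K → <⇒≱ (s≤s K≤i) (∣⇒≤ 1+i∣K))
                       | ∧-zeroʳ (not (does (p ∣? suc i))) = ℤP.*-zeroʳ (μ (suc i))

  g-at-multiple : ∀ j → g (p * suc j) ≡ - (μ (suc j) *ℤ pos (𝟙 (not (does (p ∣? suc j)) ∧ does (suc j ∣? K))))
  g-at-multiple j with p ∣? suc j
  ... | yes p∣1+j = begin
    μ (p * suc j) *ℤ pos (𝟙 (does (p * suc j ∣? p * K)))
      ≡⟨ cong (_*ℤ pos (𝟙 (does (p * suc j ∣? p * K)))) (μ-prime-*-∣ pp p∣1+j) ⟩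
    pos 0               ≡⟨ cong -_ (ℤP.*-zeroʳ (μ (suc j))) ⟨
    - (μ (suc j) *ℤ pos 0) ∎
  ... | no  p∤1+j = begin
    μ (p * suc j) *ℤ pos (𝟙 (does (p * suc j ∣? p * K)))
      ≡⟨ cong₂ (λ m b → m *ℤ pos (𝟙 b)) (μ-prime-*-∤ pp p∤1+j)
               (does-⇔ (mk⇔ (*-cancelˡ-∣ p) (*-monoʳ-∣ p)) (p * suc j ∣? p * K) (suc j ∣? K)) ⟩
    - μ (suc j) *ℤ pos (𝟙 (does (suc j ∣? K)))
      ≡⟨ ℤP.neg-distribˡ-* (μ (suc j)) _ ⟨
    - (μ (suc j) *ℤ pos (𝟙 (does (suc j ∣? K)))) ∎

divisorSumμ-self : ∀ n → divisorSumμ (suc n) (suc n) ≡ pos (𝟙 (does (suc n ≟ 1)))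
divisorSumμ-self zero    = refl
divisorSumμ-self (suc m) with prime-factor m
... | p , pp , p∣n = subst (λ x → divisorSumμ x x ≡ pos 0) p*K≡n (divisorSumμ-prime-* K {{K≢0}} pp)
  where
  instance
    p≢0 : NonZero p
    p≢0 = prime⇒nonZero pp
  K : ℕ
  K = suc (suc m) / p
  p*K≡n : p * K ≡ suc (suc m)
  p*K≡n = m*[n/m]≡n p∣n
  K≢0 : NonZero K
  K≢0 = ≢-nonZero (λ K≡0 → 0≢1+n (trans (sym (*-zeroʳ p)) (trans (cong (p *_) (sym K≡0)) p*K≡n)))

_∈[1,_] : ℕ → ℕ → Set
x ∈[1, M ] = 1 ≤ x × x ≤ M

divisorSumμ≡[n≡1] : ∀ {n M} → n ∈[1, M ] → divisorSumμ M n ≡ pos (𝟙 (does (n ≟ 1)))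
divisorSumμ≡[n≡1] {suc n} {M} (_ , n<M) = trans (ℤΣ.sumBelow-extend _ n<M beyond-n) (divisorSumμ-self n)
  where
  beyond-n : ∀ i → suc n ≤ i → i < M → μ (suc i) *ℤ pos (𝟙 (does (suc i ∣? suc n))) ≡ pos 0
  beyond-n i n<i _ rewrite dec-false (suc i ∣? suc n) (λ 1+i∣1+n → <⇒≱ (s≤s n<i) (∣⇒≤ 1+i∣1+n)) =
    ℤP.*-zeroʳ (μ (suc i))

-- Möbius inversion over subsets

subsets-All : ∀ {ℓ} {Q : Pred ℕ ℓ} {A} → All Q A → All (All Q) (subsets A)
subsets-All []         = [] ∷ []
subsets-All (qx ∷ qxs) = ++⁺ (map⁺ (All.map (qx ∷_) (subsets-All qxs))) (subsets-All qxs)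

gcdL-∈[1,] : ∀ {M} X → X ≢ [] → All (_∈[1, M ]) X → gcdL X ∈[1, M ]
gcdL-∈[1,] []       []≢[] _                   = contradiction refl []≢[]
gcdL-∈[1,] (x ∷ xs) _     ((1≤x , x≤M) ∷ _) =
  n≢0⇒n>0 (λ g≡0 → m<n⇒n≢0 1≤x (gcd[m,n]≡0⇒m≡0 g≡0)) ,
  ≤-trans (∣⇒≤ {{>-nonZero 1≤x}} (gcd[m,n]∣m x (gcdL xs))) x≤M

𝟙[b∧g≡1]≡sumμ : ∀ {M} b g → (b ≡ true → g ∈[1, M ]) →
  pos (𝟙 (b ∧ does (g ≟ 1))) ≡ ℤΣ.sumBelow M (λ i → μ (suc i) *ℤ pos (𝟙 (b ∧ does (suc i ∣? g))))
𝟙[b∧g≡1]≡sumμ {M} false g _      = sym (ℤΣ.sumBelow-zero M (λ i _ → ℤP.*-zeroʳ (μ (suc i))))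
𝟙[b∧g≡1]≡sumμ     true  g g∈[1,M] = sym (divisorSumμ≡[n≡1] (g∈[1,M] refl))

#coprimeSubsets : (ℕ → Bool) → List ℕ → ℕ
#coprimeSubsets P A = ℕΣ.sumOver (subsets A) (λ X → 𝟙 (P (length X) ∧ does (gcdL X ≟ 1)))

-- P 0 ≡ false excludes the empty set, whose gcd is 0 and so outside the range of the inversion.
#coprimeSubsets-möbius : ∀ {M} P A → P 0 ≡ false → All (_∈[1, M ]) A →
  pos (#coprimeSubsets P A) ≡ ℤΣ.sumBelow M (λ i → μ (suc i) *ℤ pos (#subsets P (filter (suc i ∣?_) A)))
#coprimeSubsets-möbius {M} P A P0≡false A⊆[1,M] = begin
  pos (#coprimeSubsets P A)
    ≡⟨ pos-sumOver (subsets A) _ ⟩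
  ℤΣ.sumOver (subsets A) (λ X → pos (𝟙 (P (length X) ∧ does (gcdL X ≟ 1))))
    ≡⟨ ℤΣ.sumOver-cong (subsets A) (All.map pointwise (subsets-All A⊆[1,M])) ⟩
  ℤΣ.sumOver (subsets A) (λ X → ℤΣ.sumBelow M (λ i → term i X))
    ≡⟨ ℤΣ.sumOver-sumBelow (subsets A) M (λ X i → term i X) ⟩
  ℤΣ.sumBelow M (λ i → ℤΣ.sumOver (subsets A) (term i))
    ≡⟨ ℤΣ.sumBelow-cong M (λ i _ → count i) ⟩
  ℤΣ.sumBelow M (λ i → μ (suc i) *ℤ pos (#subsets P (filter (suc i ∣?_) A))) ∎
  where
  open ≡-Reasoning
  term : ℕ → List ℕ → ℤ
  term i X = μ (suc i) *ℤ pos (𝟙 (P (length X) ∧ does (suc i ∣? gcdL X)))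

  nonempty : ∀ {X} → P (length X) ≡ true → X ≢ []
  nonempty PX≡true refl = contradiction (trans (sym P0≡false) PX≡true) λ ()

  pointwise : ∀ {X} → All (_∈[1, M ]) X →
    pos (𝟙 (P (length X) ∧ does (gcdL X ≟ 1))) ≡ ℤΣ.sumBelow M (λ i → term i X)
  pointwise {X} X⊆[1,M] =
    𝟙[b∧g≡1]≡sumμ (P (length X)) (gcdL X) (λ PX≡true → gcdL-∈[1,] X (nonempty PX≡true) X⊆[1,M])

  count : ∀ i → ℤΣ.sumOver (subsets A) (term i) ≡ μ (suc i) *ℤ pos (#subsets P (filter (suc i ∣?_) A))
  count i = begin
    ℤΣ.sumOver (subsets A) (term i)
      ≡⟨ *-distribˡ-sumOver (μ (suc i)) (subsets A) _ ⟨
    μ (suc i) *ℤ ℤΣ.sumOver (subsets A) (λ X → pos (𝟙 (P (length X) ∧ does (suc i ∣? gcdL X))))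
      ≡⟨ cong (μ (suc i) *ℤ_) (pos-sumOver (subsets A) _) ⟨
    μ (suc i) *ℤ pos (#subsets∣ (suc i) P A)
      ≡⟨ cong (λ n → μ (suc i) *ℤ pos n) (#subsets∣≡#subsets-filter (suc i) P A) ⟩
    μ (suc i) *ℤ pos (#subsets P (filter (suc i ∣?_) A)) ∎

#coprimeSubsets≡sumTo : ∀ {M} P A → P 0 ≡ false → All (_∈[1, M ]) A →
  (h : (d : ℕ) → .{{NonZero d}} → ℕ) → (∀ d .{{_ : NonZero d}} → #subsets P (filter (d ∣?_) A) ≡ h d) →
  pos (#coprimeSubsets P A) ≡ sumTo M (λ d ⦃ _ ⦄ → μ d *ℤ pos (h d))
#coprimeSubsets≡sumTo {M} P A P0≡false A⊆[1,M] h count = begin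
  pos (#coprimeSubsets P A)
    ≡⟨ #coprimeSubsets-möbius P A P0≡false A⊆[1,M] ⟩
  ℤΣ.sumBelow M (λ i → μ (suc i) *ℤ pos (#subsets P (filter (suc i ∣?_) A)))
    ≡⟨ ℤΣ.sumBelow-cong M (λ i _ → cong (λ n → μ (suc i) *ℤ pos n) (count (suc i))) ⟩
  ℤΣ.sumBelow M (λ i → μ (suc i) *ℤ pos (h (suc i)))
    ≡⟨ sumTo≡sumBelow M (λ d ⦃ _ ⦄ → μ d *ℤ pos (h d)) ⟨
  sumTo M (λ d ⦃ _ ⦄ → μ d *ℤ pos (h d)) ∎
  where open ≡-Reasoning

f≡#coprimeSubsets : ∀ A → f A ≡ #coprimeSubsets (0 <ᵇ_) A
f≡#coprimeSubsets A = trans (length-filter≡sum𝟙 _ (subsets A))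
  (ℕΣ.sumOver-cong (subsets A) (All.universal (λ X → cong (λ b → 𝟙 (b ∧ does (gcdL X ≟ 1))) (nonempty?≡0<length X)) _))
  where
  nonempty?≡0<length : ∀ X → nonempty? X ≡ (0 <ᵇ length X)
  nonempty?≡0<length []      = refl
  nonempty?≡0<length (_ ∷ _) = refl

fₖ≡#coprimeSubsets : ∀ k A → fₖ k A ≡ #coprimeSubsets (λ n → does (n ≟ k)) A
fₖ≡#coprimeSubsets k A = length-filter≡sum𝟙 _ (subsets A)

theorem2 : (m₁ l₂ m₂ k : ℕ) → 1 ≤ m₁ → m₁ < l₂ → l₂ ≤ m₂ → 1 ≤ k →
    (pos (f (interval 1 m₁ ++ interval l₂ m₂))
    ≡ sumTo m₂ (λ d ⦃ _ ⦄ → μ d *ℤ pos (2 ^ (m₁ / d + m₂ / d ∸ (l₂ ∸ 1) / d) ∸ 1)))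
    × (pos (fₖ k (interval 1 m₁ ++ interval l₂ m₂))
    ≡ sumTo m₂ (λ d ⦃ _ ⦄ → μ d *ℤ pos ((m₁ / d + m₂ / d ∸ (l₂ ∸ 1) / d) C k)))
theorem2 m₁ zero    m₂ k       _ ()    _     _
theorem2 m₁ (suc l) m₂ zero    _ _     _     ()
theorem2 m₁ (suc l) m₂ (suc k) _ m₁<l₂ l₂≤m₂ _ =
  trans (cong pos (f≡#coprimeSubsets A))
        (#coprimeSubsets≡sumTo (0 <ᵇ_) A refl A⊆[1,m₂] (λ d → 2 ^ multiples d ∸ 1)
          (λ d → trans (#subsets-nonempty (filter (d ∣?_) A)) (cong (λ c → 2 ^ c ∸ 1) (#multiples d)))) ,
  trans (cong pos (fₖ≡#coprimeSubsets (suc k) A))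
        (#coprimeSubsets≡sumTo (λ n → does (n ≟ suc k)) A refl A⊆[1,m₂] (λ d → multiples d C suc k)
          (λ d → trans (#subsets-ofSize (suc k) (filter (d ∣?_) A)) (cong (_C suc k) (#multiples d))))
  where
  A : List ℕ
  A = interval 1 m₁ ++ interval (suc l) m₂
  l≤m₂ : l ≤ m₂
  l≤m₂ = ≤-trans (n≤1+n l) l₂≤m₂
  A⊆[1,m₂] : All (_∈[1, m₂ ]) A
  A⊆[1,m₂] = ++⁺ (All.map (λ (1≤x , x≤m₁) → 1≤x , ≤-trans x≤m₁ (≤-trans (<⇒≤ m₁<l₂) l₂≤m₂)) (interval-bounds 1 m₁))
                 (All.map (λ (l<x , x≤m₂) → ≤-trans (s≤s z≤n) l<x , x≤m₂) (interval-bounds (suc l) m₂))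
  multiples : (d : ℕ) → .{{NonZero d}} → ℕ
  multiples d = m₁ / d + m₂ / d ∸ l / d
  #multiples : ∀ d .{{_ : NonZero d}} → length (filter (d ∣?_) A) ≡ multiples d
  #multiples d = length-filter-∣-union d m₁ l≤m₂
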